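{- Let $G$ be a connected bipartite graph of order $n=r+s\ge 4$ with stable sets $U$ and $W$, $|U|=r\le s=|W|$. If $\lambda(\overline{G})=\lambda(G)+1$, then $3\le r<s\le 2^r-1$ and $U$ is the only locating-dominating set of $G$ of cardinality $\lambda(G)$.
   Context: A set $S$ of vertices is distinguishing if $N(x)\cap S\neq N(y)\cap S$ for all distinct vertices $x,y\notin S$ ($N$ = open neighborhood); a locating-dominating set is a distinguishing set $S$ such that every vertex not in $S$ has a neighbor in $S$. $\lambda(G)$ is the minimum cardinality of a locating-dominating set of $G$, and $\overline{G}$ is the complement of $G$. -}

module Defs where

open import Data.Nat using (ℕ; suc; _+_; _≤_)
open import Data.Bool using (Bool; true; false; not; _∧_)
open import Data.Fin using (Fin; _≟_)
open import Data.Fin.Subset using (Subset; _∈_; _∉_; ∣_∣)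
open import Data.Product using (Σ; _×_; _,_)
open import Relation.Nullary using (¬_; yes; no)
open import Data.Empty using (⊥-elim)
open import Data.Bool.Properties using (∧-zeroʳ)
open import Relation.Nullary.Decidable using (⌊_⌋)
open import Relation.Binary.PropositionalEquality using (_≡_; _≢_; refl; cong₂; sym; cong)

record Graph (n : ℕ) : Set where
  field
    adj   : Fin n → Fin n → Bool
    adj-sym    : ∀ x y → adj x y ≡ adj y x
    adj-irrefl : ∀ x → adj x x ≡ false
open Graph public

complement : ∀ {n} → Graph n → Graph n
complement {n} G = record { adj = a ; adj-sym = s ; adj-irrefl = i }
  where
  a : Fin n → Fin n → Bool
  a x y = not (adj G x y) ∧ not ⌊ x ≟ y ⌋
  s : ∀ x y → a x y ≡ a y x
  s x y with x ≟ y | y ≟ x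
  ... | yes _ | yes _ = cong₂ _∧_ (cong not (adj-sym G x y)) refl
  ... | no _  | no _  = cong₂ _∧_ (cong not (adj-sym G x y)) refl
  ... | yes p | no q  = ⊥-elim (q (sym p))
  ... | no p  | yes q = ⊥-elim (p (sym q))
  i : ∀ x → a x x ≡ false
  i x with x ≟ x
  ... | yes _ = ∧-zeroʳ _
  ... | no ¬p = ⊥-elim (¬p refl)

data Reach {n : ℕ} (G : Graph n) : Fin n → Fin n → Set where
  here : ∀ {x} → Reach G x x
  step : ∀ {x y z} → adj G x y ≡ true → Reach G y z → Reach G x z

Connected : ∀ {n} → Graph n → Set
Connected G = ∀ x y → Reach G x y

Distinguishing : ∀ {n} → Graph n → Subset n → Set
Distinguishing {n} G S =
  ∀ (x y : Fin n) → x ∉ S → y ∉ S → x ≢ y →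
    Σ (Fin n) λ z → z ∈ S × adj G x z ≢ adj G y z

Dominating : ∀ {n} → Graph n → Subset n → Set
Dominating {n} G S = ∀ (x : Fin n) → x ∉ S → Σ (Fin n) λ z → z ∈ S × adj G x z ≡ true

LocatingDominating : ∀ {n} → Graph n → Subset n → Set
LocatingDominating G S = Distinguishing G S × Dominating G S

IsLocDomNumber : ∀ {n} → Graph n → ℕ → Set
IsLocDomNumber {n} G k =
  (Σ (Subset n) λ S → LocatingDominating G S × ∣ S ∣ ≡ k) ×
  (∀ (S : Subset n) → LocatingDominating G S → k ≤ ∣ S ∣)

BipartitionBy : ∀ {n} → Graph n → Subset n → Set
BipartitionBy {n} G U =
  (∀ (x y : Fin n) → x ∈ U → y ∈ U → adj G x y ≡ false) ×
  (∀ (x y : Fin n) → x ∉ U → y ∉ U → adj G x y ≡ false)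

-- Let S be a minimum locating-dominating set of G. It stays distinguishing in Ḡ, so since
-- λ(Ḡ) > |S| it must fail to dominate there: some x ∉ S is adjacent in G to all of S.
-- As G is bipartite, S is then the side not containing x. Exchanging any w ∈ S for x
-- cannot give another minimum locating-dominating set, which says that every w ∈ S is
-- needed to separate the traces on S of the vertices of the other side (with x given
-- the empty trace); Bondy's theorem then makes the other side strictly larger. Hence
-- S = U and r < s. The traces on U of the vertices of W and the empty set are pairwise
-- distinct, so s + 1 ≤ 2^r; and r = 2, s = 3 is impossible because W − x would then be
-- a locating-dominating set of Ḡ of size 2.
module Submission where

open import Defs
open import Data.Nat using (ℕ; suc; _+_; _≤_; _<_; _^_; _∸_; z≤n; s≤s; s≤s⁻¹)
open import Data.Nat.Properties
  using ( +-suc; +-comm; +-identityʳ; +-mono-≤; +-monoˡ-≤; +-monoʳ-≤; n≤1+n; ≤-trans; ≤-reflexive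
        ; ≤-antisym; >⇒≢; <⇒≱; ≰⇒>; _≤?_; suc-injective; 0≢1+n; m+1+n≰m; m^n>0; <⇒≤pred
        ; ∸-monoˡ-≤; ∸-monoʳ-≤; module ≤-Reasoning)
open import Data.Bool using (Bool; true; false; not; if_then_else_)
import Data.Bool.Properties as Bool
open import Data.Fin using (Fin; _≟_)
open import Data.Fin.Properties using (any?; all?)
open import Data.Fin.Subset
open import Data.Fin.Subset.Properties
open import Data.Fin.Subset.Induction using (⊂-wellFounded)
open import Induction.WellFounded using (Acc; acc)
open import Data.Vec using ([]; _∷_; here; there; tabulate)
open import Data.Vec.Properties using (lookup∘tabulate; []=⇒lookup; lookup⇒[]=)
open import Data.Product using (_×_; _,_; proj₁; proj₂; ∃-syntax)
open import Data.Sum using (_⊎_; inj₁; inj₂)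
open import Data.Empty using (⊥-elim)
open import Function using (_∘_; id)
open import Relation.Nullary using (¬_; yes; no; ¬?; does; contradiction)
open import Relation.Nullary.Decidable using (_×-dec_; _→-dec_)
open import Relation.Binary.PropositionalEquality

private variable
  n : ℕ

-- Subsets of Fin n

∣p∣≡1+∣p-x∣ : ∀ {x} {p : Subset n} → x ∈ p → ∣ p ∣ ≡ suc ∣ p - x ∣
∣p∣≡1+∣p-x∣ {p = inside ∷ p}  here        = cong suc (cong ∣_∣ (sym (p─⊥≡p p)))
∣p∣≡1+∣p-x∣ {p = inside ∷ p}  (there x∈p) = cong suc (∣p∣≡1+∣p-x∣ x∈p)
∣p∣≡1+∣p-x∣ {p = outside ∷ p} (there x∈p) = ∣p∣≡1+∣p-x∣ x∈p

∣p∣≡1+m⇒∣p-x∣≡m : ∀ {x m} {p : Subset n} → x ∈ p → ∣ p ∣ ≡ suc m → ∣ p - x ∣ ≡ m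
∣p∣≡1+m⇒∣p-x∣≡m x∈p ∣p∣≡1+m = suc-injective (trans (sym (∣p∣≡1+∣p-x∣ x∈p)) ∣p∣≡1+m)

∣p∪q∣≤∣p∣+∣q∣ : ∀ (p q : Subset n) → ∣ p ∪ q ∣ ≤ ∣ p ∣ + ∣ q ∣
∣p∪q∣≤∣p∣+∣q∣ []            []            = z≤n
∣p∪q∣≤∣p∣+∣q∣ (inside ∷ p)  (inside ∷ q)  = s≤s (≤-trans (∣p∪q∣≤∣p∣+∣q∣ p q) (+-monoʳ-≤ ∣ p ∣ (n≤1+n ∣ q ∣)))
∣p∪q∣≤∣p∣+∣q∣ (inside ∷ p)  (outside ∷ q) = s≤s (∣p∪q∣≤∣p∣+∣q∣ p q)
∣p∪q∣≤∣p∣+∣q∣ (outside ∷ p) (inside ∷ q)  = ≤-trans (s≤s (∣p∪q∣≤∣p∣+∣q∣ p q)) (≤-reflexive (sym (+-suc _ _)))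
∣p∪q∣≤∣p∣+∣q∣ (outside ∷ p) (outside ∷ q) = ∣p∪q∣≤∣p∣+∣q∣ p q

∣p∣≡∣p∩q∣+∣p─q∣ : ∀ (p q : Subset n) → ∣ p ∣ ≡ ∣ p ∩ q ∣ + ∣ p ─ q ∣
∣p∣≡∣p∩q∣+∣p─q∣ []            []            = refl
∣p∣≡∣p∩q∣+∣p─q∣ (inside ∷ p)  (inside ∷ q)  = cong suc (∣p∣≡∣p∩q∣+∣p─q∣ p q)
∣p∣≡∣p∩q∣+∣p─q∣ (inside ∷ p)  (outside ∷ q) = trans (cong suc (∣p∣≡∣p∩q∣+∣p─q∣ p q)) (sym (+-suc _ _))
∣p∣≡∣p∩q∣+∣p─q∣ (outside ∷ p) (inside ∷ q)  = ∣p∣≡∣p∩q∣+∣p─q∣ p q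
∣p∣≡∣p∩q∣+∣p─q∣ (outside ∷ p) (outside ∷ q) = ∣p∣≡∣p∩q∣+∣p─q∣ p q

∣p-x∪⁅y⁆∣≤∣p∣ : ∀ {x y} {p : Subset n} → x ∈ p → ∣ (p - x) ∪ ⁅ y ⁆ ∣ ≤ ∣ p ∣
∣p-x∪⁅y⁆∣≤∣p∣ {x = x} {y} {p} x∈p = begin
  ∣ (p - x) ∪ ⁅ y ⁆ ∣      ≤⟨ ∣p∪q∣≤∣p∣+∣q∣ (p - x) ⁅ y ⁆ ⟩
  ∣ p - x ∣ + ∣ ⁅ y ⁆ ∣    ≡⟨ cong (∣ p - x ∣ +_) (∣⁅x⁆∣≡1 y) ⟩
  ∣ p - x ∣ + 1            ≡⟨ +-comm ∣ p - x ∣ 1 ⟩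
  suc ∣ p - x ∣            ≡⟨ ∣p∣≡1+∣p-x∣ x∈p ⟨
  ∣ p ∣                    ∎
  where open ≤-Reasoning

x∈p─q⇒x∉q : ∀ {x} {p q : Subset n} → x ∈ p ─ q → x ∉ q
x∈p─q⇒x∉q {p = _ ∷ _} {inside ∷ _} () here
x∈p─q⇒x∉q {p = _ ∷ _} {_ ∷ _}      (there x∈p─q) (there x∈q) = x∈p─q⇒x∉q x∈p─q x∈q

p─q⊆p-x : ∀ {x} {p q : Subset n} → x ∈ q → p ─ q ⊆ p - x
p─q⊆p-x {p = p} {q} x∈q y∈ = x∈p∧x≢y⇒x∈p-y (p─q⊆p p q y∈) λ { refl → x∈p─q⇒x∉q y∈ x∈q }

p─q⊆p─[q-x] : ∀ {x} {p q : Subset n} → p ─ q ⊆ p ─ (q - x)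
p─q⊆p─[q-x] {x = x} {p} {q} y∈ = x∈p∧x∉q⇒x∈p─q (p─q⊆p p q y∈) (x∈p─q⇒x∉q y∈ ∘ p─q⊆p q ⁅ x ⁆)

x∈p⇒x∈p─[q-x] : ∀ {x} {p q : Subset n} → x ∈ p → x ∈ p ─ (q - x)
x∈p⇒x∈p─[q-x] {x = x} x∈p = x∈p∧x∉q⇒x∈p─q x∈p λ x∈q-x → x∈p─q⇒x∉q x∈q-x (x∈⁅x⁆ x)

x∈∁p∪⁅y⁆⇒x∉p : ∀ {x y} {p : Subset n} → x ∈ ∁ p ∪ ⁅ y ⁆ → x ≢ y → x ∉ p
x∈∁p∪⁅y⁆⇒x∉p {y = y} {p} x∈ x≢y with x∈p∪q⁻ (∁ p) ⁅ y ⁆ x∈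
... | inj₁ x∈∁p  = x∈∁p⇒x∉p x∈∁p
... | inj₂ x∈⁅y⁆ = contradiction (x∈⁅y⁆⇒x≡y y x∈⁅y⁆) x≢y

∈-tabulate⁺ : ∀ {f : Fin n → Bool} {x} → f x ≡ true → x ∈ tabulate f
∈-tabulate⁺ {f = f} {x} fx = lookup⇒[]= x (tabulate f) (trans (lookup∘tabulate f x) fx)

∈-tabulate⁻ : ∀ {f : Fin n → Bool} {x} → x ∈ tabulate f → f x ≡ true
∈-tabulate⁻ {f = f} {x} x∈ = trans (sym (lookup∘tabulate f x)) ([]=⇒lookup x∈)

Nonempty⇒0<∣p∣ : ∀ {p : Subset n} → Nonempty p → 0 < ∣ p ∣
Nonempty⇒0<∣p∣ (x , x∈p) = ≤-trans (s≤s z≤n) (≤-reflexive (sym (∣p∣≡1+∣p-x∣ x∈p)))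

Empty⇒∣p∣≡0 : ∀ {p : Subset n} → Empty p → ∣ p ∣ ≡ 0
Empty⇒∣p∣≡0 {n} empty = trans (cong ∣_∣ (Empty-unique empty)) (∣⊥∣≡0 n)

0<∣p∣⇒Nonempty : ∀ {p : Subset n} → 0 < ∣ p ∣ → Nonempty p
0<∣p∣⇒Nonempty {p = p} 0<∣p∣ with nonempty? p
... | yes nonempty = nonempty
... | no empty     = contradiction (Empty⇒∣p∣≡0 empty) (>⇒≢ 0<∣p∣)

∣p∣≤1 : ∀ {p : Subset n} → (∀ {a b} → a ∈ p → b ∈ p → a ≡ b) → ∣ p ∣ ≤ 1
∣p∣≤1 {p = p} unique with nonempty? p
... | no empty      = subst (_≤ 1) (sym (Empty⇒∣p∣≡0 empty)) z≤n
... | yes (a , a∈p) = ≤-trans (p⊆q⇒∣p∣≤∣q∣ p⊆⁅a⁆) (≤-reflexive (∣⁅x⁆∣≡1 a))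
  where
  p⊆⁅a⁆ : p ⊆ ⁅ a ⁆
  p⊆⁅a⁆ b∈p = subst (_∈ ⁅ a ⁆) (unique a∈p b∈p) (x∈⁅x⁆ a)

two-elements : ∀ {p : Subset n} → ∣ p ∣ ≡ 2 →
               ∃[ a ] ∃[ b ] a ∈ p × b ∈ p × a ≢ b × (∀ {c} → c ∈ p → c ≡ a ⊎ c ≡ b)
two-elements {p = p} ∣p∣≡2 with 0<∣p∣⇒Nonempty (subst (0 <_) (sym ∣p∣≡2) (s≤s z≤n))
... | a , a∈p with 0<∣p∣⇒Nonempty (subst (0 <_) (sym (∣p∣≡1+m⇒∣p-x∣≡m a∈p ∣p∣≡2)) (s≤s z≤n))
... | b , b∈p-a = a , b , a∈p , p─q⊆p p ⁅ a ⁆ b∈p-a , a≢b , a-or-b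
  where
  a≢b : a ≢ b
  a≢b refl = x∈p─q⇒x∉q b∈p-a (x∈⁅x⁆ a)
  ∣p-a-b∣≡0 : ∣ p - a - b ∣ ≡ 0
  ∣p-a-b∣≡0 = ∣p∣≡1+m⇒∣p-x∣≡m b∈p-a (∣p∣≡1+m⇒∣p-x∣≡m a∈p ∣p∣≡2)
  a-or-b : ∀ {c} → c ∈ p → c ≡ a ⊎ c ≡ b
  a-or-b {c} c∈p with c ≟ a | c ≟ b
  ... | yes c≡a | _       = inj₁ c≡a
  ... | no _    | yes c≡b = inj₂ c≡b
  ... | no c≢a  | no c≢b  =
    ⊥-elim (0≢1+n (trans (sym ∣p-a-b∣≡0) (∣p∣≡1+∣p-x∣ (x∈p∧x≢y⇒x∈p-y (x∈p∧x≢y⇒x∈p-y c∈p c≢a) c≢b))))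

-- Families of vertices separated by their traces

module _ {n : ℕ} (t : Fin n → Fin n → Bool) where

  Agree : Subset n → Fin n → Fin n → Set
  Agree C b b′ = ∀ a → a ∈ C → t b a ≡ t b′ a

  Separates : Subset n → Subset n → Set
  Separates C P = ∀ {b b′} → b ∈ P → b′ ∈ P → b ≢ b′ → ∃[ a ] a ∈ C × t b a ≢ t b′ a

  Collision : Subset n → Subset n → Set
  Collision C P = ∃[ b ] ∃[ b′ ] b ∈ P × b′ ∈ P × b ≢ b′ × Agree C b b′

  private variable
    b b′ b″ : Fin n
    C D P P′ : Subset n

  agree-sym : Agree C b b′ → Agree C b′ b
  agree-sym agree a a∈C = sym (agree a a∈C)

  agree-trans : Agree C b b′ → Agree C b′ b″ → Agree C b b″
  agree-trans agree agree′ a a∈C = trans (agree a a∈C) (agree′ a a∈C)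

  agree-empty : Empty C → Agree C b b′
  agree-empty empty a a∈C = contradiction (a , a∈C) empty

  agree-⊆ : D ⊆ C → Agree C b b′ → Agree D b b′
  agree-⊆ D⊆C agree a a∈D = agree a (D⊆C a∈D)

  separates⇒agree⇒≡ : Separates C P → b ∈ P → b′ ∈ P → Agree C b b′ → b ≡ b′
  separates⇒agree⇒≡ {b = b} {b′} sep b∈P b′∈P agree with b ≟ b′
  ... | yes b≡b′ = b≡b′
  ... | no b≢b′ with sep b∈P b′∈P b≢b′
  ... | a , a∈C , differ = contradiction (agree a a∈C) differ

  separates-or-collision : ∀ C P → Separates C P ⊎ Collision C P
  separates-or-collision C P with any? (λ b → any? (λ b′ →
      (b ∈? P) ×-dec (b′ ∈? P) ×-dec ¬? (b ≟ b′) ×-dec all? (λ a → (a ∈? C) →-dec (t b a Bool.≟ t b′ a))))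
  ... | yes collision  = inj₂ collision
  ... | no ∄collision = inj₁ separates
    where
    separates : Separates C P
    separates {b} {b′} b∈P b′∈P b≢b′ with any? (λ a → (a ∈? C) ×-dec ¬? (t b a Bool.≟ t b′ a))
    ... | yes disagreement  = disagreement
    ... | no ∄disagreement = contradiction (b , b′ , b∈P , b′∈P , b≢b′ , agree) ∄collision
      where
      agree : Agree C b b′
      agree a a∈C with t b a Bool.≟ t b′ a
      ... | yes equal  = equal
      ... | no unequal = contradiction (a , a∈C , unequal) ∄disagreement

  separates-⊆ : P′ ⊆ P → Separates C P → Separates C P′
  separates-⊆ P′⊆P sep b∈P′ b′∈P′ = sep (P′⊆P b∈P′) (P′⊆P b′∈P′)

  separates-remove : ∀ {u c} → (∀ {b} → b ∈ P → t b u ≡ c) → Separates C P → Separates (C - u) P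
  separates-remove {u = u} constant sep b∈P b′∈P b≢b′ with sep b∈P b′∈P b≢b′
  ... | a , a∈C , differ with a ≟ u
  ... | yes refl = contradiction (trans (constant b∈P) (sym (constant b′∈P))) differ
  ... | no a≢u   = a , x∈p∧x≢y⇒x∈p-y a∈C a≢u , differ

  ∣P∣≤2^∣C∣ : Separates C P → ∣ P ∣ ≤ 2 ^ ∣ C ∣
  ∣P∣≤2^∣C∣ = bound _ _ (⊂-wellFounded _)
    where
    bound : ∀ C P → Acc _⊂_ C → Separates C P → ∣ P ∣ ≤ 2 ^ ∣ C ∣
    bound C P (acc smaller) sep with nonempty? C
    ... | no empty =
      ≤-trans (∣p∣≤1 λ b∈P b′∈P → separates⇒agree⇒≡ sep b∈P b′∈P (agree-empty empty)) (m^n>0 2 ∣ C ∣)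
    ... | yes (u , u∈C) = begin
      ∣ P ∣                            ≡⟨ ∣p∣≡∣p∩q∣+∣p─q∣ P N ⟩
      ∣ P ∩ N ∣ + ∣ P ─ N ∣            ≤⟨ +-mono-≤ (half (p∩q⊆p P N) inN) (half (p─q⊆p P N) outN) ⟩
      2 ^ ∣ C - u ∣ + 2 ^ ∣ C - u ∣    ≡⟨ cong (2 ^ ∣ C - u ∣ +_) (sym (+-identityʳ _)) ⟩
      2 ^ suc ∣ C - u ∣                ≡⟨ cong (2 ^_) (∣p∣≡1+∣p-x∣ u∈C) ⟨
      2 ^ ∣ C ∣                        ∎
      where
      open ≤-Reasoning
      N : Subset n
      N = tabulate λ b → t b u
      inN : ∀ {b} → b ∈ P ∩ N → t b u ≡ true
      inN = ∈-tabulate⁻ ∘ proj₂ ∘ x∈p∩q⁻ P N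
      outN : ∀ {b} → b ∈ P ─ N → t b u ≡ false
      outN b∈P─N = Bool.¬-not (x∈p─q⇒x∉q b∈P─N ∘ ∈-tabulate⁺)
      half : ∀ {P′ c} → P′ ⊆ P → (∀ {b} → b ∈ P′ → t b u ≡ c) → ∣ P′ ∣ ≤ 2 ^ ∣ C - u ∣
      half P′⊆P constant = bound (C - u) _ (smaller (x∈p⇒p-x⊂p u∈C))
                             (separates-remove constant (separates-⊆ P′⊆P sep))

  -- Bondy's argument: deleting the coordinates of L one at a time, each deletion merges
  -- two classes of P.
  record Merging (C P L : Subset n) : Set where
    field
      class     : Fin n → Fin n
      classes   : Subset n
      class∈    : b ∈ P → class b ∈ classes
      sameClass : b ∈ P → b′ ∈ P → class b ≡ class b′ → Agree (C ─ L) b b′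
      size      : ∣ classes ∣ + ∣ L ∣ ≤ ∣ P ∣

  merge : ∀ {C P L w} → Separates C P → w ∈ L → w ∈ C → Collision (C - w) P →
          Merging C P (L - w) → Merging C P L
  merge {C} {P} {L} {w} sep w∈L w∈C (b , b′ , b∈P , b′∈P , b≢b′ , agree) M = record
    { class = class′ ; classes = classes - class b′ ; class∈ = class∈′ ; sameClass = sameClass′ ; size = size′ }
    where
    open Merging M
    distinct : class b ≢ class b′
    distinct same = b≢b′ (separates⇒agree⇒≡ sep b∈P b′∈P agreeC)
      where
      agreeC : Agree C b b′
      agreeC a a∈C with a ≟ w
      ... | yes refl = sameClass b∈P b′∈P same a (x∈p⇒x∈p─[q-x] w∈C)
      ... | no a≢w   = agree a (x∈p∧x≢y⇒x∈p-y a∈C a≢w)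
    class′ : Fin n → Fin n
    class′ r = if does (class r ≟ class b′) then class b else class r
    class∈′ : ∀ {r} → r ∈ P → class′ r ∈ classes - class b′
    class∈′ {r} r∈P with class r ≟ class b′
    ... | yes _ = x∈p∧x≢y⇒x∈p-y (class∈ b∈P) distinct
    ... | no r≢b′ = x∈p∧x≢y⇒x∈p-y (class∈ r∈P) r≢b′
    same : ∀ {r r′} → r ∈ P → r′ ∈ P → class r ≡ class r′ → Agree (C ─ L) r r′
    same r∈P r′∈P eq = agree-⊆ p─q⊆p─[q-x] (sameClass r∈P r′∈P eq)
    agree′ : Agree (C ─ L) b b′
    agree′ = agree-⊆ (p─q⊆p-x w∈L) agree
    sameClass′ : ∀ {r r′} → r ∈ P → r′ ∈ P → class′ r ≡ class′ r′ → Agree (C ─ L) r r′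
    sameClass′ {r} {r′} r∈P r′∈P eq with class r ≟ class b′ | class r′ ≟ class b′
    ... | yes r~b′ | yes r′~b′ = same r∈P r′∈P (trans r~b′ (sym r′~b′))
    ... | yes r~b′ | no _      =
      agree-trans (same r∈P b′∈P r~b′) (agree-trans (agree-sym agree′) (same b∈P r′∈P eq))
    ... | no _     | yes r′~b′ =
      agree-trans (same r∈P b∈P eq) (agree-trans agree′ (same b′∈P r′∈P (sym r′~b′)))
    ... | no _     | no _      = same r∈P r′∈P eq
    size′ : ∣ classes - class b′ ∣ + ∣ L ∣ ≤ ∣ P ∣
    size′ = begin
      ∣ classes - class b′ ∣ + ∣ L ∣         ≡⟨ cong (∣ classes - class b′ ∣ +_) (∣p∣≡1+∣p-x∣ w∈L) ⟩
      ∣ classes - class b′ ∣ + suc ∣ L - w ∣ ≡⟨ +-suc _ _ ⟩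
      suc ∣ classes - class b′ ∣ + ∣ L - w ∣ ≡⟨ cong (_+ ∣ L - w ∣) (∣p∣≡1+∣p-x∣ (class∈ b′∈P)) ⟨
      ∣ classes ∣ + ∣ L - w ∣                ≤⟨ size ⟩
      ∣ P ∣                                  ∎
      where open ≤-Reasoning

  merging : Separates C P → (∀ {w} → w ∈ C → Collision (C - w) P) →
            ∀ L → Acc _⊂_ L → L ⊆ C → Merging C P L
  merging {C} {P} sep collision L (acc smaller) L⊆C with nonempty? L
  ... | no empty = record
    { class = id ; classes = P ; class∈ = id ; sameClass = λ { _ _ refl _ _ → refl }
    ; size = ≤-reflexive (trans (cong (∣ P ∣ +_) (Empty⇒∣p∣≡0 empty)) (+-identityʳ _)) }
  ... | yes (w , w∈L) = merge sep w∈L (L⊆C w∈L) (collision (L⊆C w∈L))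
    (merging sep collision (L - w) (smaller (x∈p⇒p-x⊂p w∈L)) (L⊆C ∘ p─q⊆p L ⁅ w ⁆))

  bondy : Separates C P → Nonempty P → (∀ {w} → w ∈ C → ¬ Separates (C - w) P) → ∣ C ∣ < ∣ P ∣
  bondy {C} {P} sep (x , x∈P) essential = begin-strict
    ∣ C ∣                  <⟨ +-monoˡ-≤ ∣ C ∣ (Nonempty⇒0<∣p∣ (class x , class∈ x∈P)) ⟩
    ∣ classes ∣ + ∣ C ∣    ≤⟨ size ⟩
    ∣ P ∣                  ∎
    where
    open ≤-Reasoning
    collision : ∀ {w} → w ∈ C → Collision (C - w) P
    collision {w} w∈C with separates-or-collision (C - w) P
    ... | inj₁ separates = ⊥-elim (essential w∈C separates)
    ... | inj₂ collides  = collides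
    open Merging (merging sep collision C (⊂-wellFounded C) id)

-- Locating-dominating sets in a graph and its complement

-- The trace of b in G, except that z gets the empty trace; z is then separated from
-- every other member of a family exactly when that member has a neighbour in the set.
adjExcept : Graph n → Fin n → Fin n → Fin n → Bool
adjExcept G z b a = if does (b ≟ z) then false else adj G b a

module _ {n : ℕ} (G : Graph n) where

  private variable
    a b v v′ w x z : Fin n
    A S U : Subset n

  Universal : Subset n → Fin n → Set
  Universal S x = ∀ z → z ∈ S → adj G x z ≡ true

  adjExcept-self : adjExcept G z z a ≡ false
  adjExcept-self {z} with z ≟ z
  ... | yes _   = refl
  ... | no z≢z = contradiction refl z≢z

  adjExcept-other : b ≢ z → adjExcept G z b a ≡ adj G b a
  adjExcept-other {b} {z} b≢z with b ≟ z
  ... | yes b≡z = contradiction b≡z b≢z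
  ... | no _    = refl

  distinguishing⇒separates : Distinguishing G S → Separates (adj G) S (∁ S)
  distinguishing⇒separates dist b∈∁S b′∈∁S = dist _ _ (x∈∁p⇒x∉p b∈∁S) (x∈∁p⇒x∉p b′∈∁S)

  locDom⇒separates : LocatingDominating G S → Separates (adjExcept G z) S (∁ S ∪ ⁅ z ⁆)
  locDom⇒separates {S} {z} (dist , dom) {b} {b′} b∈ b′∈ b≢b′ with b ≟ z | b′ ≟ z
  ... | yes refl | yes refl = contradiction refl b≢b′
  ... | yes refl | no b′≢z  = let a , a∈S , b′~a = dom b′ (x∈∁p∪⁅y⁆⇒x∉p b′∈ b′≢z) in
    a , a∈S , λ eq → contradiction (trans eq b′~a) λ ()
  ... | no b≢z   | yes refl = let a , a∈S , b~a = dom b (x∈∁p∪⁅y⁆⇒x∉p b∈ b≢z) in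
    a , a∈S , λ eq → contradiction (trans (sym eq) b~a) λ ()
  ... | no b≢z   | no b′≢z  = dist b b′ (x∈∁p∪⁅y⁆⇒x∉p b∈ b≢z) (x∈∁p∪⁅y⁆⇒x∉p b′∈ b′≢z) b≢b′

  ∣∁S∣<2^∣S∣ : LocatingDominating G S → z ∈ S → ∣ ∁ S ∣ < 2 ^ ∣ S ∣
  ∣∁S∣<2^∣S∣ {S} {z} ld z∈S = begin-strict
    ∣ ∁ S ∣            <⟨ p⊂q⇒∣p∣<∣q∣ (p⊆p∪q ⁅ z ⁆ , z , x∈p∪q⁺ (inj₂ (x∈⁅x⁆ z)) , x∈p⇒x∉∁p z∈S) ⟩
    ∣ ∁ S ∪ ⁅ z ⁆ ∣    ≤⟨ ∣P∣≤2^∣C∣ (adjExcept G z) (locDom⇒separates ld) ⟩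
    2 ^ ∣ S ∣          ∎
    where open ≤-Reasoning

  adj-complement : x ≢ z → adj (complement G) x z ≡ not (adj G x z)
  adj-complement {x} {z} x≢z with x ≟ z
  ... | yes x≡z = contradiction x≡z x≢z
  ... | no _    = Bool.∧-identityʳ _

  ∈⇒≢ : z ∈ S → x ∉ S → x ≢ z
  ∈⇒≢ z∈S x∉S refl = x∉S z∈S

  distinguishing-complement : Distinguishing G S → Distinguishing (complement G) S
  distinguishing-complement dist x y x∉S y∉S x≢y with dist x y x∉S y∉S x≢y
  ... | z , z∈S , differ = z , z∈S , λ eq → differ (Bool.not-injective (begin
    not (adj G x z)          ≡⟨ adj-complement (∈⇒≢ z∈S x∉S) ⟨
    adj (complement G) x z   ≡⟨ eq ⟩
    adj (complement G) y z   ≡⟨ adj-complement (∈⇒≢ z∈S y∉S) ⟩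
    not (adj G y z)          ∎))
    where open ≡-Reasoning

  complement-locDom : Distinguishing G S → (∀ x → x ∉ S → ∃[ z ] z ∈ S × adj G x z ≡ false) →
                      LocatingDominating (complement G) S
  complement-locDom dist nonNeighbour = distinguishing-complement dist , dom
    where
    dom : Dominating (complement G) _
    dom x x∉S = let z , z∈S , x≁z = nonNeighbour x x∉S in
      z , z∈S , trans (adj-complement (∈⇒≢ z∈S x∉S)) (cong not x≁z)

  ¬complement-locDom⇒universal : Distinguishing G S → ¬ LocatingDominating (complement G) S →
                                  ∃[ x ] x ∉ S × Universal S x
  ¬complement-locDom⇒universal {S} dist ¬ld
    with any? (λ x → ¬? (x ∈? S) ×-dec all? (λ z → (z ∈? S) →-dec (adj G x z Bool.≟ true)))
  ... | yes universal  = universal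
  ... | no ∄universal = contradiction (complement-locDom dist nonNeighbour) ¬ld
    where
    nonNeighbour : ∀ x → x ∉ S → ∃[ z ] z ∈ S × adj G x z ≡ false
    nonNeighbour x x∉S with any? (λ z → (z ∈? S) ×-dec (adj G x z Bool.≟ false))
    ... | yes found  = found
    ... | no ∄found = contradiction (x , x∉S , universal) ∄universal
      where
      universal : Universal S x
      universal z z∈S = Bool.¬-not λ x≁z → ∄found (z , z∈S , x≁z)

  bipartition-∁ : BipartitionBy G U → BipartitionBy G (∁ U)
  bipartition-∁ (stableU , stableW) =
    (λ x y x∈∁U y∈∁U → stableW x y (x∈∁p⇒x∉p x∈∁U) (x∈∁p⇒x∉p y∈∁U)) ,
    (λ x y x∉∁U y∉∁U → stableU x y (x∉∁p⇒x∈p x∉∁U) (x∉∁p⇒x∈p y∉∁U))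

  universal⇒side : BipartitionBy G U → Dominating G S → x ∉ U → Universal S x → S ≡ U
  universal⇒side {U} {S} {x} (stableU , stableW) dom x∉U universal = ⊆-antisym S⊆U U⊆S
    where
    S⊆U : S ⊆ U
    S⊆U {z} z∈S with z ∈? U
    ... | yes z∈U = z∈U
    ... | no z∉U  = contradiction (trans (sym (universal z z∈S)) (stableW x z x∉U z∉U)) λ ()
    U⊆S : U ⊆ S
    U⊆S {u} u∈U with u ∈? S
    ... | yes u∈S = u∈S
    ... | no u∉S  = let z , z∈S , u~z = dom u u∉S in
      contradiction (trans (sym u~z) (stableU u z u∈U (S⊆U z∈S))) λ ()

  exchange-locDom : BipartitionBy G A → x ∉ A → Universal A x → w ∈ A →
                    Separates (adjExcept G x) (A - w) (∁ A) → LocatingDominating G ((A - w) ∪ ⁅ x ⁆)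
  exchange-locDom {A} {x} {w} (_ , stableW) x∉A universal w∈A sep = dist , dom
    where
    T : Subset n
    T = (A - w) ∪ ⁅ x ⁆
    x∈T : x ∈ T
    x∈T = x∈p∪q⁺ (inj₂ (x∈⁅x⁆ x))
    ∈T : a ∈ A - w → a ∈ T
    ∈T = x∈p∪q⁺ ∘ inj₁
    outsideT : v ∉ T → v ≡ w ⊎ (v ≢ x × v ∉ A)
    outsideT {v} v∉T with v ≟ w
    ... | yes v≡w = inj₁ v≡w
    ... | no v≢w  = inj₂ ((λ { refl → v∉T x∈T }) , λ v∈A → v∉T (∈T (x∈p∧x≢y⇒x∈p-y v∈A v≢w)))
    w~x : adj G w x ≡ true
    w~x = trans (adj-sym G w x) (universal w w∈A)
    ≁x : v ∉ A → adj G v x ≡ false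
    ≁x v∉A = stableW _ x v∉A x∉A
    separate : v ∉ A → v′ ∉ A → v ≢ v′ → ∃[ a ] a ∈ A - w × adjExcept G x v a ≢ adjExcept G x v′ a
    separate v∉A v′∉A = sep (x∉p⇒x∈∁p v∉A) (x∉p⇒x∈∁p v′∉A)
    dist : Distinguishing G T
    dist v v′ v∉T v′∉T v≢v′ with outsideT v∉T | outsideT v′∉T
    ... | inj₁ refl | inj₁ refl = contradiction refl v≢v′
    ... | inj₁ refl | inj₂ (_ , v′∉A) =
      x , x∈T , λ eq → contradiction (trans (sym w~x) (trans eq (≁x v′∉A))) λ ()
    ... | inj₂ (_ , v∉A) | inj₁ refl =
      x , x∈T , λ eq → contradiction (trans (sym w~x) (trans (sym eq) (≁x v∉A))) λ ()
    ... | inj₂ (v≢x , v∉A) | inj₂ (v′≢x , v′∉A) = let a , a∈ , differ = separate v∉A v′∉A v≢v′ in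
      a , ∈T a∈ , λ eq → differ (trans (adjExcept-other v≢x) (trans eq (sym (adjExcept-other v′≢x))))
    dom : Dominating G T
    dom v v∉T with outsideT v∉T
    ... | inj₁ refl = x , x∈T , w~x
    ... | inj₂ (v≢x , v∉A) = let a , a∈ , differ = separate v∉A x∉A v≢x in
      a , ∈T a∈ , Bool.¬-not λ v≁a → differ (trans (adjExcept-other v≢x) (trans v≁a (sym adjExcept-self)))

module TwoByTwo {n : ℕ} (G : Graph n) {U : Subset n} {x : Fin n}
  (bip : BipartitionBy G U) (ldU : LocatingDominating G U) (x∉U : x ∉ U) (universal : Universal G U x)
  {u₁ u₂ : Fin n} (u₁∈U : u₁ ∈ U) (u₂∈U : u₂ ∈ U) (u₁-or-u₂ : ∀ {u} → u ∈ U → u ≡ u₁ ⊎ u ≡ u₂)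
  {w₁ w₂ : Fin n} (w₁∈T : w₁ ∈ ∁ U - x) (w₂∈T : w₂ ∈ ∁ U - x) (w₁≢w₂ : w₁ ≢ w₂) where

  private variable
    u v v′ w : Fin n

  T : Subset n
  T = ∁ U - x

  ∈T⇒∉U : w ∈ T → w ∉ U
  ∈T⇒∉U = x∈∁p⇒x∉p ∘ p─q⊆p (∁ U) ⁅ x ⁆

  ∈T⇒≢x : w ∈ T → w ≢ x
  ∈T⇒≢x = x∉⁅y⁆⇒x≢y ∘ x∈p─q⇒x∉q

  x≁T : w ∈ T → adj G x w ≡ false
  x≁T w∈T = proj₂ bip x _ x∉U (∈T⇒∉U w∈T)

  ∉T⇒x∨U : v ∉ T → v ≡ x ⊎ v ∈ U
  ∉T⇒x∨U {v} v∉T with v ≟ x | v ∈? U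
  ... | yes v≡x | _        = inj₁ v≡x
  ... | no _    | yes v∈U  = inj₂ v∈U
  ... | no v≢x  | no v∉U   = contradiction (x∈p∧x≢y⇒x∈p-y (x∉p⇒x∈∁p v∉U) v≢x) v∉T

  agree-on-U⇒≡ : v ∉ U → v′ ∉ U → adj G v u₁ ≡ adj G v′ u₁ → adj G v u₂ ≡ adj G v′ u₂ → v ≡ v′
  agree-on-U⇒≡ v∉U v′∉U eq₁ eq₂ =
    separates⇒agree⇒≡ (adj G) (distinguishing⇒separates G (proj₁ ldU)) (x∉p⇒x∈∁p v∉U) (x∉p⇒x∈∁p v′∉U) agree
    where
    agree : Agree (adj G) U _ _
    agree u u∈U with u₁-or-u₂ u∈U
    ... | inj₁ refl = eq₁
    ... | inj₂ refl = eq₂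

  -- x is adjacent to both u₁ and u₂, so the other traces on U must be singletons.
  exactly-one : w ∈ T → adj G w u₁ ≢ adj G w u₂
  exactly-one {w} w∈T eq = ∈T⇒≢x w∈T
    (agree-on-U⇒≡ (∈T⇒∉U w∈T) x∉U (trans w~u₁ (sym (universal u₁ u₁∈U)))
                                  (trans (trans (sym eq) w~u₁) (sym (universal u₂ u₂∈U))))
    where
    w~u₁ : adj G w u₁ ≡ true
    w~u₁ with proj₂ ldU w (∈T⇒∉U w∈T)
    ... | z , z∈U , w~z with u₁-or-u₂ z∈U
    ... | inj₁ refl = w~z
    ... | inj₂ refl = trans eq w~z

  ≢-flip : ∀ {p q r s : Bool} → p ≢ q → r ≢ s → p ≡ r → q ≡ s
  ≢-flip p≢q r≢s refl = trans (Bool.¬-not (p≢q ∘ sym)) (sym (Bool.¬-not (r≢s ∘ sym)))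

  w₁-w₂-differ : u ∈ U → adj G u w₁ ≢ adj G u w₂
  w₁-w₂-differ {u} u∈U eq with u₁-or-u₂ u∈U
  ... | inj₁ refl = w₁≢w₂ (agree-on-U⇒≡ (∈T⇒∉U w₁∈T) (∈T⇒∉U w₂∈T) eq′
                      (≢-flip (exactly-one w₁∈T) (exactly-one w₂∈T) eq′))
    where eq′ = trans (adj-sym G w₁ u) (trans eq (adj-sym G u w₂))
  ... | inj₂ refl = w₁≢w₂ (agree-on-U⇒≡ (∈T⇒∉U w₁∈T) (∈T⇒∉U w₂∈T)
                      (≢-flip (exactly-one w₁∈T ∘ sym) (exactly-one w₂∈T ∘ sym) eq′) eq′)
    where eq′ = trans (adj-sym G w₁ u) (trans eq (adj-sym G u w₂))

  neighbour : ∀ c → u ∈ U → ∃[ z ] z ∈ T × adj G u z ≡ c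
  neighbour {u} c u∈U with adj G u w₁ Bool.≟ c
  ... | yes u~w₁ = w₁ , w₁∈T , u~w₁
  ... | no u≁w₁  = w₂ , w₂∈T , (begin
    adj G u w₂         ≡⟨ Bool.¬-not (w₁-w₂-differ u∈U ∘ sym) ⟩
    not (adj G u w₁)   ≡⟨ cong not (Bool.¬-not u≁w₁) ⟩
    not (not c)        ≡⟨ Bool.not-involutive c ⟩
    c                  ∎)
    where open ≡-Reasoning

  dist : Distinguishing G T
  dist v v′ v∉T v′∉T v≢v′ with ∉T⇒x∨U v∉T | ∉T⇒x∨U v′∉T
  ... | inj₁ refl | inj₁ refl = contradiction refl v≢v′
  ... | inj₁ refl | inj₂ v′∈U = let z , z∈T , v′~z = neighbour true v′∈U in
    z , z∈T , λ eq → contradiction (trans (sym (x≁T z∈T)) (trans eq v′~z)) λ ()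
  ... | inj₂ v∈U | inj₁ refl = let z , z∈T , v~z = neighbour true v∈U in
    z , z∈T , λ eq → contradiction (trans (sym (x≁T z∈T)) (trans (sym eq) v~z)) λ ()
  ... | inj₂ v∈U | inj₂ v′∈U with u₁-or-u₂ v∈U | u₁-or-u₂ v′∈U
  ... | inj₁ refl | inj₁ refl = contradiction refl v≢v′
  ... | inj₂ refl | inj₂ refl = contradiction refl v≢v′
  ... | inj₁ refl | inj₂ refl =
    w₁ , w₁∈T , λ eq → exactly-one w₁∈T (trans (adj-sym G w₁ v) (trans eq (adj-sym G v′ w₁)))
  ... | inj₂ refl | inj₁ refl =
    w₁ , w₁∈T , λ eq → exactly-one w₁∈T (trans (adj-sym G w₁ v′) (trans (sym eq) (adj-sym G v w₁)))

  nonNeighbour : ∀ v → v ∉ T → ∃[ z ] z ∈ T × adj G v z ≡ false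
  nonNeighbour v v∉T with ∉T⇒x∨U v∉T
  ... | inj₁ refl = w₁ , w₁∈T , x≁T w₁∈T
  ... | inj₂ v∈U  = neighbour false v∈U

  locDom-complement : LocatingDominating (complement G) T
  locDom-complement = complement-locDom G dist nonNeighbour

∣U∣≡2⇒complement-locDom : ∀ (G : Graph n) {U x} → BipartitionBy G U → LocatingDominating G U →
                           x ∉ U → Universal G U x → ∣ U ∣ ≡ 2 → ∣ ∁ U - x ∣ ≡ 2 →
                           LocatingDominating (complement G) (∁ U - x)
∣U∣≡2⇒complement-locDom G bip ldU x∉U universal ∣U∣≡2 ∣T∣≡2 with two-elements ∣U∣≡2 | two-elements ∣T∣≡2
... | u₁ , u₂ , u₁∈U , u₂∈U , _ , u₁-or-u₂ | w₁ , w₂ , w₁∈T , w₂∈T , w₁≢w₂ , _ =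
  TwoByTwo.locDom-complement G bip ldU x∉U universal u₁∈U u₂∈U u₁-or-u₂ w₁∈T w₂∈T w₁≢w₂

-- Graphs with λ(Ḡ) = λ(G) + 1

module LocDomGap {n : ℕ} (G : Graph n) (k : ℕ)
  (λ-minimal : ∀ S → LocatingDominating G S → k ≤ ∣ S ∣)
  (λ̄-minimal : ∀ S → LocatingDominating (complement G) S → k + 1 ≤ ∣ S ∣) where

  private variable
    x : Fin n
    A S U : Subset n

  ∣S∣≡k⇒¬complement-locDom : ∣ S ∣ ≡ k → ¬ LocatingDominating (complement G) S
  ∣S∣≡k⇒¬complement-locDom {S} ∣S∣≡k ld = m+1+n≰m k (subst (k + 1 ≤_) ∣S∣≡k (λ̄-minimal S ld))

  λ-set-side : BipartitionBy G A → LocatingDominating G S → ∣ S ∣ ≡ k → S ≡ A ⊎ S ≡ ∁ A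
  λ-set-side {A} bip (dist , dom) ∣S∣≡k
    with ¬complement-locDom⇒universal G dist (∣S∣≡k⇒¬complement-locDom ∣S∣≡k)
  ... | x , _ , universal with x ∈? A
  ... | no x∉A  = inj₁ (universal⇒side G bip dom x∉A universal)
  ... | yes x∈A = inj₂ (universal⇒side G (bipartition-∁ G bip) dom (x∈p⇒x∉∁p x∈A) universal)

  side-smaller : BipartitionBy G A → 4 ≤ n → LocatingDominating G A → ∣ A ∣ ≡ k →
                 x ∉ A → Universal G A x → ∣ A ∣ < ∣ ∁ A ∣
  side-smaller {A} {x} bip 4≤n ldA ∣A∣≡k x∉A universal with ∣ A ∣ ≤? 1
  ... | yes ∣A∣≤1 = begin-strict
    ∣ A ∣        ≤⟨ ∣A∣≤1 ⟩
    1            <⟨ s≤s (s≤s z≤n) ⟩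
    4 ∸ 1        ≤⟨ ∸-monoˡ-≤ 1 4≤n ⟩
    n ∸ 1        ≤⟨ ∸-monoʳ-≤ n ∣A∣≤1 ⟩
    n ∸ ∣ A ∣    ≡⟨ ∣∁p∣≡n∸∣p∣ A ⟨
    ∣ ∁ A ∣      ∎
    where open ≤-Reasoning
  ... | no ∣A∣≰1 = bondy (adjExcept G x) (separates-⊆ _ (p⊆p∪q ⁅ x ⁆) (locDom⇒separates G ldA))
                         (x , x∉p⇒x∈∁p x∉A) essential
    where
    exchanged : ∀ {w} → w ∈ A → Separates (adjExcept G x) (A - w) (∁ A) →
                LocatingDominating G ((A - w) ∪ ⁅ x ⁆)
    exchanged = exchange-locDom G bip x∉A universal
    A-w-nonempty : ∀ {w} → w ∈ A → Nonempty (A - w)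
    A-w-nonempty w∈A = 0<∣p∣⇒Nonempty (s≤s⁻¹ (subst (1 <_) (∣p∣≡1+∣p-x∣ w∈A) (≰⇒> ∣A∣≰1)))
    essential : ∀ {w} → w ∈ A → ¬ Separates (adjExcept G x) (A - w) (∁ A)
    essential {w} w∈A sep
      with λ-set-side bip (exchanged w∈A sep)
             (≤-antisym (≤-trans (∣p-x∪⁅y⁆∣≤∣p∣ w∈A) (≤-reflexive ∣A∣≡k)) (λ-minimal _ (exchanged w∈A sep)))
    ... | inj₁ T≡A  = x∉A (subst (x ∈_) T≡A (x∈p∪q⁺ (inj₂ (x∈⁅x⁆ x))))
    ... | inj₂ T≡∁A = let a , a∈A-w = A-w-nonempty w∈A in
      x∈∁p⇒x∉p (subst (a ∈_) T≡∁A (x∈p∪q⁺ (inj₁ a∈A-w))) (p─q⊆p A ⁅ w ⁆ a∈A-w)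

  λ-set≡U : BipartitionBy G U → 4 ≤ n → ∣ U ∣ ≤ ∣ ∁ U ∣ → LocatingDominating G S → ∣ S ∣ ≡ k → S ≡ U
  λ-set≡U {U} bip 4≤n r≤s ld ∣S∣≡k with λ-set-side bip ld ∣S∣≡k
  ... | inj₁ S≡U = S≡U
  ... | inj₂ refl with ¬complement-locDom⇒universal G (proj₁ ld) (∣S∣≡k⇒¬complement-locDom ∣S∣≡k)
  ... | x , x∉∁U , universal = contradiction r≤s (<⇒≱ (begin-strict
    ∣ ∁ U ∣       <⟨ side-smaller (bipartition-∁ G bip) 4≤n ld ∣S∣≡k x∉∁U universal ⟩
    ∣ ∁ (∁ U) ∣   ≤⟨ p⊆q⇒∣p∣≤∣q∣ {q = U} (x∉∁p⇒x∈p ∘ x∈∁p⇒x∉p) ⟩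
    ∣ U ∣         ∎))
    where open ≤-Reasoning

3≤r : ∀ {r s} → r < s → suc s ≤ 2 ^ r → ¬ (r ≡ 2 × s ≡ 3) → 3 ≤ r
3≤r {0} {suc _}                   _              (s≤s ())                   _
3≤r {1} {1}                       (s≤s ())       _                          _
3≤r {1} {suc (suc _)}             _              (s≤s (s≤s ()))             _
3≤r {2} {2}                       (s≤s (s≤s ())) _                          _
3≤r {2} {3}                       _              _                          r,s≢2,3 = ⊥-elim (r,s≢2,3 (refl , refl))
3≤r {2} {suc (suc (suc (suc _)))} _              (s≤s (s≤s (s≤s (s≤s ())))) _
3≤r {suc (suc (suc _))}           _              _                          _ = s≤s (s≤s (s≤s z≤n))

corollary16 : ∀ {n : ℕ} (G : Graph n) (U : Subset n) (k : ℕ) →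
    Connected G → BipartitionBy G U → 4 ≤ n → ∣ U ∣ ≤ ∣ ∁ U ∣ →
    IsLocDomNumber G k → IsLocDomNumber (complement G) (k + 1) →
    (3 ≤ ∣ U ∣ × ∣ U ∣ < ∣ ∁ U ∣ × ∣ ∁ U ∣ ≤ 2 ^ ∣ U ∣ ∸ 1) ×
    (LocatingDominating G U × ∣ U ∣ ≡ k) ×
    (∀ (S : Subset n) → LocatingDominating G S → ∣ S ∣ ≡ k → S ≡ U)
corollary16 G U k _ bip 4≤n r≤s ((S₀ , ldS₀ , ∣S₀∣≡k) , λ-minimal) (_ , λ̄-minimal) =
  let x , x∉U , x-universal = ¬complement-locDom⇒universal G (proj₁ ldU) (∣S∣≡k⇒¬complement-locDom ∣U∣≡k)
      u , u∈U , _ = proj₂ ldU x x∉U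
      r<s = side-smaller bip 4≤n ldU ∣U∣≡k x∉U x-universal
      s<2^r = ∣∁S∣<2^∣S∣ G ldU u∈U
      r,s≢2,3 = λ (r≡2 , s≡3) →
        let ∣∁U-x∣≡2 = ∣p∣≡1+m⇒∣p-x∣≡m (x∉p⇒x∈∁p x∉U) s≡3 in
        ∣S∣≡k⇒¬complement-locDom (trans ∣∁U-x∣≡2 (trans (sym r≡2) ∣U∣≡k))
          (∣U∣≡2⇒complement-locDom G bip ldU x∉U x-universal r≡2 ∣∁U-x∣≡2)
  in (3≤r r<s s<2^r r,s≢2,3 , r<s , <⇒≤pred s<2^r) , (ldU , ∣U∣≡k) , unique
  where
  open LocDomGap G k λ-minimal λ̄-minimal
  unique : ∀ S → LocatingDominating G S → ∣ S ∣ ≡ k → S ≡ U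
  unique S = λ-set≡U bip 4≤n r≤s
  ldU : LocatingDominating G U
  ldU = subst (LocatingDominating G) (unique S₀ ldS₀ ∣S₀∣≡k) ldS₀
  ∣U∣≡k : ∣ U ∣ ≡ k
  ∣U∣≡k = subst (λ S → ∣ S ∣ ≡ k) (unique S₀ ldS₀ ∣S₀∣≡k) ∣S₀∣≡k
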